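{- Let $(\mathbf{C},\mathcal{M})$ satisfy the standing DPO assumptions of the context, and let $R_j=(r_j,\mathsf{c}_{I_j})$, $r_j=(O_j\xleftarrow{o_j}K_j\xrightarrow{i_j}I_j)$, $j=1,2$, be linear rules with application conditions. Then the trivial match $\mu_\varnothing=(I_2\leftarrow\varnothing\to O_1)$ is an admissible match, $\mu_\varnothing\in M_{R_2}(R_1)$, if and only if the composite condition $$\mathsf{c}_{I_{21}}=\mathsf{Shift}(I_1\to I_2+I_1,\mathsf{c}_{I_1})\wedge\mathsf{Trans}\big((I_2+O_1\xleftarrow{id_{I_2}+o_1}I_2+K_1\xrightarrow{id_{I_2}+i_1}I_2+I_1),\ \mathsf{Shift}(I_2\to I_2+O_1,\mathsf{c}_{I_2})\big)$$ (with coproduct injections as the shifting morphisms) is not equivalent to $\mathsf{false}$.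
   Context: Standing DPO assumptions: $(\mathbf{C},\mathcal{M})$ is $\mathcal{M}$-adhesive with $\mathcal{M}$ a class of monomorphisms (contains isos; closed under composition and decomposition; pushouts/pullbacks along $\mathcal{M}$-morphisms exist and $\mathcal{M}$ is stable under them; pushouts along $\mathcal{M}$-morphisms are $\mathcal{M}$-van Kampen squares); $\mathbf{C}$ has epi-$\mathcal{M}$-factorizations, is balanced, has a strict $\mathcal{M}$-initial object $\varnothing$ (a unique monomorphism $\varnothing\to A$ for each $A$, in $\mathcal{M}$; every morphism into $\varnothing$ is iso), and $\mathcal{M}$-effective unions. Binary coproducts exist with injections in $\mathcal{M}$. Conditions over $P$: $\mathsf{true}$; $\exists(a,\mathsf{c}_Q)$ ($a:P\to Q$ in $\mathcal{M}$); $\neg$; $\bigwedge$; $\mathsf{false}=\neg\mathsf{true}$; $\bigvee=\neg\bigwedge\neg$; $\mathcal{M}$-morphism $p\models\exists(a,\mathsf{c}_Q)$ iff $p=q a$ for an $\mathcal{M}$-morphism $q\models\mathsf{c}_Q$; $\equiv$: satisfied by the same $\mathcal{M}$-morphisms. $\mathsf{Shift}(p,\cdot)$ along $\mathcal{M}$-morphism $p:P\to Q$ commutes with $\mathsf{true},\neg,\bigwedge$, and $\mathsf{Shift}(p,\exists(a:P\to A,\mathsf{c}_A))=\bigvee_{(r,s)}\exists(r,\mathsf{Shift}(s,\mathsf{c}_A))$ over iso classes of pushouts $(r,s)$ of spans $Q\xleftarrow{p''}X\xrightarrow{a''}A$ of $\mathcal{M}$-morphisms admitting $x:P\to X$ in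 $\mathcal{M}$ with $p''x=p$, $a''x=a$. Linear rules: spans of $\mathcal{M}$-morphisms. $\mathsf{Trans}(r,\mathsf{c}_O)$ for $r=(O\xleftarrow{o}K\xrightarrow{i}I)$: commutes with $\mathsf{true},\neg,\bigwedge$; $\exists(a:O\to O',\mathsf{c}')\mapsto\exists(a^*,\mathsf{Trans}(r',\mathsf{c}'))$ if a pushout complement $K\to K'\xrightarrow{o'}O'$ of $K\xrightarrow{o}O\xrightarrow{a}O'$ exists ($I\xrightarrow{a^*}I'\xleftarrow{i'}K'$ the pushout of $I\leftarrow K\to K'$, $r'=(O'\xleftarrow{o'}K'\xrightarrow{i'}I')$), else $\mapsto\mathsf{false}$. Composition/admissibility: for a span $\mu_{21}=(I_2\leftarrow M_{21}\to O_1)$ of $\mathcal{M}$-morphisms with pushout $I_2\xrightarrow{m_2'}N_{21}\xleftarrow{m_1'}O_1$, require pushout complements $K_2\to K_2'\to N_{21}$ of $K_2\xrightarrow{i_2}I_2\to N_{21}$ and $K_1\to K_1'\to N_{21}$ of $K_1\xrightarrow{o_1}O_1\to N_{21}$; $I_{21}$ = pushout of $K_1'\leftarrow K_1\to I_1$ with $p_1:I_1\to I_{21}$; $\mathsf{c}_{I_{21}}=\mathsf{Shift}(p_1,\mathsf{c}_{I_1})\wedge\mathsf{Trans}((N_{21}\leftarrow K_1'\to I_{21}),\mathsf{Shift}(m_2',\mathsf{c}_{I_2}))$. $\mu_{21}\in M_{R_2}(R_1)$ iff all this is constructible and $\mathsf{c}_{I_{21}}\not\equiv\mathsf{false}$.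 -}

module Defs where

open import Level using (Level; _⊔_; suc; Lift; lift)
open import Relation.Binary using (Rel; IsEquivalence)
open import Data.Product using (Σ; _×_; _,_; proj₁; proj₂)
open import Data.Bool using (Bool; true; false)
open import Relation.Nullary using (¬_)
import Data.Unit.Polymorphic as UP

record Category (o ℓ e : Level) : Set (suc (o ⊔ ℓ ⊔ e)) where
  infixr 9 _∘_
  infix 4 _≈_
  field
    Obj : Set o
    Hom : Obj → Obj → Set ℓ
    _≈_ : ∀ {A B} → Rel (Hom A B) e
    id  : ∀ {A} → Hom A A
    _∘_ : ∀ {A B C} → Hom B C → Hom A B → Hom A C
    ≈-equiv : ∀ {A B} → IsEquivalence (_≈_ {A} {B})
    assoc : ∀ {A B C D} {f : Hom A B} {g : Hom B C} {h : Hom C D} →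
            (h ∘ g) ∘ f ≈ h ∘ (g ∘ f)
    identityˡ : ∀ {A B} {f : Hom A B} → id ∘ f ≈ f
    identityʳ : ∀ {A B} {f : Hom A B} → f ∘ id ≈ f
    ∘-resp-≈ : ∀ {A B C} {f h : Hom B C} {g i : Hom A B} →
               f ≈ h → g ≈ i → f ∘ g ≈ h ∘ i

module Notions {o ℓ e : Level} (𝐂 : Category o ℓ e) where
  open Category 𝐂

  Mono : ∀ {A B} → Hom A B → Set (o ⊔ ℓ ⊔ e)
  Mono {A} f = ∀ {X} (g h : Hom X A) → f ∘ g ≈ f ∘ h → g ≈ h

  Epi : ∀ {A B} → Hom A B → Set (o ⊔ ℓ ⊔ e)
  Epi {B = B} f = ∀ {X} (g h : Hom B X) → g ∘ f ≈ h ∘ f → g ≈ h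

  Iso : ∀ {A B} → Hom A B → Set (ℓ ⊔ e)
  Iso {A} {B} f = Σ (Hom B A) λ g → (g ∘ f ≈ id) × (f ∘ g ≈ id)

  record IsPushout {A B C D} (f : Hom A B) (g : Hom A C)
                   (i₁ : Hom B D) (i₂ : Hom C D) : Set (o ⊔ ℓ ⊔ e) where
    field
      commute : i₁ ∘ f ≈ i₂ ∘ g
      universal : ∀ {X} (h : Hom B X) (k : Hom C X) → h ∘ f ≈ k ∘ g →
        Σ (Hom D X) λ u → (u ∘ i₁ ≈ h) × (u ∘ i₂ ≈ k) ×
          (∀ (u' : Hom D X) → u' ∘ i₁ ≈ h → u' ∘ i₂ ≈ k → u' ≈ u)

  record IsPullback {A B C D} (f : Hom B D) (g : Hom C D)
                    (p₁ : Hom A B) (p₂ : Hom A C) : Set (o ⊔ ℓ ⊔ e) where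
    field
      commute : f ∘ p₁ ≈ g ∘ p₂
      universal : ∀ {X} (h : Hom X B) (k : Hom X C) → f ∘ h ≈ g ∘ k →
        Σ (Hom X A) λ u → (p₁ ∘ u ≈ h) × (p₂ ∘ u ≈ k) ×
          (∀ (u' : Hom X A) → p₁ ∘ u' ≈ h → p₂ ∘ u' ≈ k → u' ≈ u)

  record PushoutOf {A B C} (f : Hom A B) (g : Hom A C) : Set (o ⊔ ℓ ⊔ e) where
    field
      {D} : Obj
      i₁ : Hom B D
      i₂ : Hom C D
      isPushout : IsPushout f g i₁ i₂

  record PullbackOf {B C D} (f : Hom B D) (g : Hom C D) : Set (o ⊔ ℓ ⊔ e) where
    field
      {A} : Obj
      p₁ : Hom A B
      p₂ : Hom A C
      isPullback : IsPullback f g p₁ p₂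

  IsPushout-sym : ∀ {A B C D} {f : Hom A B} {g : Hom A C} {i₁ : Hom B D} {i₂ : Hom C D} →
                  IsPushout f g i₁ i₂ → IsPushout g f i₂ i₁
  IsPushout-sym {f = f} {g} {i₁} {i₂} po = record
    { commute = IsEquivalence.sym ≈-equiv (IsPushout.commute po)
    ; universal = λ h k eq →
        let (u , p , q , r) = IsPushout.universal po k h (IsEquivalence.sym ≈-equiv eq)
        in u , q , p , λ u' a b → r u' b a
    }

module _ {o ℓ e : Level} (𝐂 : Category o ℓ e) where
  open Category 𝐂
  open Notions 𝐂

  MorClass : (m : Level) → Set (o ⊔ ℓ ⊔ suc m)
  MorClass m = ∀ {A B} → Hom A B → Set m

  module _ {m : Level} (M : MorClass m) where

    -- Pushout  (f , g , g' , f')  (bottom face, g' ∘ f ≈ f' ∘ g) is an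
    -- M-van Kampen square: for every commutative cube over it whose back faces
    -- are pullbacks and whose vertical morphisms b, c, d are in M,
    -- the top face is a pushout iff the front faces are pullbacks.
    IsMVanKampen : ∀ {A B C D} (f : Hom A B) (g : Hom A C) (g' : Hom B D) (f' : Hom C D) →
                   Set (o ⊔ ℓ ⊔ e ⊔ m)
    IsMVanKampen {A} {B} {C} {D} f g g' f' =
      ∀ {A' B' C' D'} (ft : Hom A' B') (gt : Hom A' C') (g't : Hom B' D') (f't : Hom C' D')
        (a : Hom A' A) (b : Hom B' B) (c : Hom C' C) (d : Hom D' D) →
      M b → M c → M d →
      g't ∘ ft ≈ f't ∘ gt →
      f ∘ a ≈ b ∘ ft → g ∘ a ≈ c ∘ gt → g' ∘ b ≈ d ∘ g't → f' ∘ c ≈ d ∘ f't →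
      IsPullback f b a ft → IsPullback g c a gt →
      (IsPushout ft gt g't f't → IsPullback g' d b g't × IsPullback f' d c f't) ×
      (IsPullback g' d b g't × IsPullback f' d c f't → IsPushout ft gt g't f't)

    record DPOSetting : Set (suc (o ⊔ ℓ ⊔ e ⊔ m)) where
      field
        M-resp-≈ : ∀ {A B} {f g : Hom A B} → f ≈ g → M f → M g
        M-mono   : ∀ {A B} {f : Hom A B} → M f → Mono f
        M-iso    : ∀ {A B} {f : Hom A B} → Iso f → M f
        M-comp   : ∀ {A B C} {f : Hom A B} {g : Hom B C} → M f → M g → M (g ∘ f)
        M-decomp : ∀ {A B C} {f : Hom A B} {g : Hom B C} → M (g ∘ f) → M g → M f
        pushout-along-M  : ∀ {A B C} (f : Hom A B) (g : Hom A C) → M g → PushoutOf f g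
        pushout-stable   : ∀ {A B C D} {f : Hom A B} {g : Hom A C} {i₁ : Hom B D} {i₂ : Hom C D} →
                           IsPushout f g i₁ i₂ → M g → M i₁
        pullback-along-M : ∀ {B C D} (f : Hom B D) (g : Hom C D) → M g → PullbackOf f g
        pullback-stable  : ∀ {A B C D} {f : Hom B D} {g : Hom C D} {p₁ : Hom A B} {p₂ : Hom A C} →
                           IsPullback f g p₁ p₂ → M g → M p₁
        van-Kampen : ∀ {A B C D} {f : Hom A B} {g : Hom A C} {g' : Hom B D} {f' : Hom C D} →
                     M f → IsPushout f g g' f' → IsMVanKampen f g g' f'
        epi-M-factor : ∀ {A B} (f : Hom A B) →
          Σ Obj λ X → Σ (Hom A X) λ ε → Σ (Hom X B) λ μ → Epi ε × M μ × (f ≈ μ ∘ ε)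
        balanced : ∀ {A B} {f : Hom A B} → Mono f → Epi f → Iso f
        ∅ : Obj
        ¡ : ∀ A → Hom ∅ A
        ¡-unique : ∀ {A} (f : Hom ∅ A) → f ≈ ¡ A
        ¡-M : ∀ A → M (¡ A)
        ∅-strict : ∀ {A} (f : Hom A ∅) → Iso f
        effective-unions : ∀ {A B C D E} (b : Hom B D) (c : Hom C D)
          (a₁ : Hom A B) (a₂ : Hom A C) (e₁ : Hom B E) (e₂ : Hom C E) (u : Hom E D) →
          M b → M c → IsPullback b c a₁ a₂ → IsPushout a₁ a₂ e₁ e₂ →
          u ∘ e₁ ≈ b → u ∘ e₂ ≈ c → M u
        _+_ : Obj → Obj → Obj
        inl : ∀ {A B} → Hom A (A + B)
        inr : ∀ {A B} → Hom B (A + B)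
        [_,_] : ∀ {A B X} → Hom A X → Hom B X → Hom (A + B) X
        inl-commute : ∀ {A B X} {f : Hom A X} {g : Hom B X} → [ f , g ] ∘ inl ≈ f
        inr-commute : ∀ {A B X} {f : Hom A X} {g : Hom B X} → [ f , g ] ∘ inr ≈ g
        copair-unique : ∀ {A B X} {f : Hom A X} {g : Hom B X} {h : Hom (A + B) X} →
                        h ∘ inl ≈ f → h ∘ inr ≈ g → h ≈ [ f , g ]
        inl-M : ∀ {A B} → M (inl {A} {B})
        inr-M : ∀ {A B} → M (inr {A} {B})

      _⊕_ : ∀ A {B C} → Hom B C → Hom (A + B) (A + C)
      A ⊕ f = [ inl , inr ∘ f ]

module DPO {lo lh le lm : Level} {𝐂 : Category lo lh le} {M : MorClass 𝐂 lm}
           (S : DPOSetting 𝐂 M) where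
  open Category 𝐂
  open Notions 𝐂
  open DPOSetting S

  κ : Level
  κ = lo ⊔ lh ⊔ le ⊔ lm

  data Cond (P : Obj) : Set (suc κ) where
    tt   : Cond P
    ex   : ∀ {Q} (a : Hom P Q) → M a → Cond Q → Cond P
    neg  : Cond P → Cond P
    conj : (I : Set κ) → (I → Cond P) → Cond P

  ff : ∀ {P} → Cond P
  ff = neg tt

  disj : ∀ {P} (I : Set κ) → (I → Cond P) → Cond P
  disj I f = neg (conj I (λ i → neg (f i)))

  _∧_ : ∀ {P} → Cond P → Cond P → Cond P
  c ∧ d = conj (Lift κ Bool) λ { (lift true) → c ; (lift false) → d }

  _⊨_ : ∀ {P X} → Hom P X → Cond P → Set κ
  p ⊨ tt = UP.⊤
  _⊨_ {X = X} p (ex {Q} a _ c) = Σ (Hom Q X) λ q → M q × (p ≈ q ∘ a) × (q ⊨ c)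
  p ⊨ neg c = ¬ (p ⊨ c)
  p ⊨ conj I f = ∀ i → p ⊨ f i

  _≡c_ : ∀ {P} → Cond P → Cond P → Set κ
  _≡c_ {P} c d = ∀ {X} (p : Hom P X) → M p → ((p ⊨ c → p ⊨ d) × (p ⊨ d → p ⊨ c))

  -- index of the disjunction in Shift(p, ∃(a, c)): spans Q ← X → A of
  -- M-morphisms admitting x : P → X in M with p'' x = p, a'' x = a,
  -- together with a pushout (r , s) of the span.
  record ShiftIdx {P Q A} (p : Hom P Q) (a : Hom P A) : Set κ where
    field
      {X T} : Obj
      x   : Hom P X
      p'' : Hom X Q
      a'' : Hom X A
      x-M : M x
      p''-M : M p''
      a''-M : M a''
      p-eq : p'' ∘ x ≈ p
      a-eq : a'' ∘ x ≈ a
      r : Hom Q T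
      s : Hom A T
      po : IsPushout p'' a'' r s

  Shift : ∀ {P Q} → Hom P Q → Cond P → Cond Q
  Shift p tt = tt
  Shift p (ex a a-M c) =
    disj (ShiftIdx p a) λ j →
      ex (ShiftIdx.r j) (pushout-stable (ShiftIdx.po j) (ShiftIdx.a''-M j))
         (Shift (ShiftIdx.s j) c)
  Shift p (neg c) = neg (Shift p c)
  Shift p (conj I f) = conj I (λ i → Shift p (f i))

  record PushoutComplement {K O O'} (o : Hom K O) (a : Hom O O') : Set κ where
    field
      {K'} : Obj
      k  : Hom K K'
      o' : Hom K' O'
      isPushout : IsPushout o k a o'

  -- IsTrans o i c t :  t is (a choice of) Trans((O ←o K →i I), c)
  data IsTrans : ∀ {O K I} → Hom K O → Hom K I → Cond O → Cond I → Set (suc κ) where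
    tr-tt   : ∀ {O K I} {o : Hom K O} {i : Hom K I} → IsTrans o i tt tt
    tr-neg  : ∀ {O K I} {o : Hom K O} {i : Hom K I} {c t} →
              IsTrans o i c t → IsTrans o i (neg c) (neg t)
    tr-conj : ∀ {O K I} {o : Hom K O} {i : Hom K I} {J : Set κ} {f g} →
              (∀ j → IsTrans o i (f j) (g j)) → IsTrans o i (conj J f) (conj J g)
    tr-ex   : ∀ {O K I O' K' I'} {o : Hom K O} {i : Hom K I}
              (a : Hom O O') (a-M : M a) (c' : Cond O')
              (k : Hom K K') (o' : Hom K' O') → IsPushout o k a o' →
              (a* : Hom I I') (i' : Hom K' I') → IsPushout i k a* i' → (a*-M : M a*) →
              {t' : Cond I'} → IsTrans o' i' c' t' →
              IsTrans o i (ex a a-M c') (ex a* a*-M t')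
    tr-ex-none : ∀ {O K I O'} {o : Hom K O} {i : Hom K I}
              (a : Hom O O') (a-M : M a) (c' : Cond O') →
              ¬ PushoutComplement o a →
              IsTrans o i (ex a a-M c') ff

  record RuleAC : Set (suc κ) where
    field
      {O K I} : Obj
      o : Hom K O
      i : Hom K I
      o-M : M o
      i-M : M i
      c : Cond I

  record AdmissibilityData (R₂ R₁ : RuleAC) {M₂₁ : Obj}
         (u : Hom M₂₁ (RuleAC.I R₂)) (v : Hom M₂₁ (RuleAC.O R₁)) : Set (suc κ) where
    module R₂ = RuleAC R₂
    module R₁ = RuleAC R₁
    field
      {N₂₁ K₂' K₁' I₂₁} : Obj
      m₂' : Hom R₂.I N₂₁
      m₁' : Hom R₁.O N₂₁
      N-po : IsPushout u v m₂' m₁'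
      k₂ : Hom R₂.K K₂'
      n₂ : Hom K₂' N₂₁
      K₂'-pc : IsPushout R₂.i k₂ m₂' n₂
      k₁ : Hom R₁.K K₁'
      n₁ : Hom K₁' N₂₁
      K₁'-pc : IsPushout R₁.o k₁ m₁' n₁
      p₁ : Hom R₁.I I₂₁
      j₁ : Hom K₁' I₂₁
      I₂₁-po : IsPushout R₁.i k₁ p₁ j₁
      trans : Cond I₂₁
      trans-is : IsTrans n₁ j₁ (Shift m₂' R₂.c) trans

    composite : Cond I₂₁
    composite = Shift p₁ R₁.c ∧ trans

  Admissible : (R₂ R₁ : RuleAC) {M₂₁ : Obj}
               (u : Hom M₂₁ (RuleAC.I R₂)) (v : Hom M₂₁ (RuleAC.O R₁)) → Set (suc κ)
  Admissible R₂ R₁ u v =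
    Σ (AdmissibilityData R₂ R₁ u v) λ D → ¬ (AdmissibilityData.composite D ≡c ff)

-- With the trivial match every object of the composition construction is
-- forced up to isomorphism: N₂₁ is the pushout of I₂ ← ∅ → O₁, i.e. the
-- coproduct I₂ + O₁; pushout complements along M are unique up to
-- isomorphism (a consequence of the van Kampen property), so K₁' ≅ I₂ + K₁
-- and I₂₁ ≅ I₂ + I₁. Satisfaction, Shift and Trans are all invariant under
-- isomorphisms of their data, so the composite condition of any
-- admissibility witness is an isomorphic copy of Shift(inr, c₁) ∧ t and is
-- equivalent to false exactly when that condition is. Conversely the
-- coproduct squares themselves form an admissibility witness whose
-- composite condition is literally Shift(inr, c₁) ∧ t.
module Submission where

open import Defs
open import Level using (Level; lift; suc)
open import Data.Product using (Σ; _×_; _,_; proj₁; proj₂)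
open import Data.Bool using (true; false)
open import Data.Empty using (⊥-elim)
open import Relation.Nullary using (¬_)
open import Relation.Binary using (IsEquivalence; Setoid)
open import Function using (_⇔_; mk⇔; Equivalence)
import Relation.Binary.Reasoning.Setoid as SetoidReasoning

module Development {o ℓ e m : Level} {𝐂 : Category o ℓ e} {M : MorClass 𝐂 m}
                   (S : DPOSetting 𝐂 M) where
  open Category 𝐂
  open Notions 𝐂
  open DPOSetting S
  open DPO S

  module ≈ {A B : Obj} = IsEquivalence (≈-equiv {A} {B})

  hom-setoid : ∀ {A B} → Setoid ℓ e
  hom-setoid {A} {B} = record { Carrier = Hom A B ; _≈_ = _≈_ ; isEquivalence = ≈-equiv }

  module HomReasoning {A B : Obj} where
    open SetoidReasoning (hom-setoid {A} {B}) public
  open HomReasoning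

  infixr 4 _⟩∘⟨_ refl⟩∘⟨_
  infixl 5 _⟩∘⟨refl

  _⟩∘⟨_ : ∀ {A B C} {f h : Hom B C} {g i : Hom A B} → f ≈ h → g ≈ i → f ∘ g ≈ h ∘ i
  _⟩∘⟨_ = ∘-resp-≈

  refl⟩∘⟨_ : ∀ {A B C} {f : Hom B C} {g i : Hom A B} → g ≈ i → f ∘ g ≈ f ∘ i
  refl⟩∘⟨ p = ∘-resp-≈ ≈.refl p

  _⟩∘⟨refl : ∀ {A B C} {f h : Hom B C} {g : Hom A B} → f ≈ h → f ∘ g ≈ h ∘ g
  p ⟩∘⟨refl = ∘-resp-≈ p ≈.refl

  sym-assoc : ∀ {A B C D} {f : Hom A B} {g : Hom B C} {h : Hom C D} →
              h ∘ (g ∘ f) ≈ (h ∘ g) ∘ f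
  sym-assoc = ≈.sym assoc

  id-comm : ∀ {A B} {f : Hom A B} → f ∘ id ≈ id ∘ f
  id-comm = ≈.trans identityʳ (≈.sym identityˡ)

  cancelʳ : ∀ {A B C} {g : Hom A B} {h : Hom B A} {k : Hom A C} → h ∘ g ≈ id → (k ∘ h) ∘ g ≈ k
  cancelʳ {g = g} {h} {k} hg = begin
    (k ∘ h) ∘ g ≈⟨ assoc ⟩
    k ∘ (h ∘ g) ≈⟨ refl⟩∘⟨ hg ⟩
    k ∘ id      ≈⟨ identityʳ ⟩
    k           ∎

  cancelˡ : ∀ {A B C} {g : Hom A B} {h : Hom B A} {k : Hom C A} → h ∘ g ≈ id → h ∘ (g ∘ k) ≈ k
  cancelˡ {g = g} {h} {k} hg = begin
    h ∘ (g ∘ k) ≈⟨ sym-assoc ⟩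
    (h ∘ g) ∘ k ≈⟨ hg ⟩∘⟨refl ⟩
    id ∘ k      ≈⟨ identityˡ ⟩
    k           ∎

  cancelInner : ∀ {A B C D} {f : Hom A B} {g : Hom B C} {h : Hom C B} {k : Hom B D} →
                h ∘ g ≈ id → (k ∘ h) ∘ (g ∘ f) ≈ k ∘ f
  cancelInner {f = f} {g} {h} {k} hg = begin
    (k ∘ h) ∘ (g ∘ f) ≈⟨ assoc ⟩
    k ∘ (h ∘ (g ∘ f)) ≈⟨ refl⟩∘⟨ cancelˡ hg ⟩
    k ∘ f             ∎

  extendˡ : ∀ {A B B' C D} {p : Hom B' C} {q : Hom A B'} {r : Hom B C} {s : Hom A B}
            (x : Hom C D) → p ∘ q ≈ r ∘ s → (x ∘ p) ∘ q ≈ (x ∘ r) ∘ s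
  extendˡ {p = p} {q} {r} {s} x pq≈rs = begin
    (x ∘ p) ∘ q ≈⟨ assoc ⟩
    x ∘ (p ∘ q) ≈⟨ refl⟩∘⟨ pq≈rs ⟩
    x ∘ (r ∘ s) ≈⟨ sym-assoc ⟩
    (x ∘ r) ∘ s ∎

  inv : ∀ {A B} {f : Hom A B} → Iso f → Hom B A
  inv = proj₁

  isoˡ : ∀ {A B} {f : Hom A B} (i : Iso f) → inv i ∘ f ≈ id
  isoˡ i = proj₁ (proj₂ i)

  isoʳ : ∀ {A B} {f : Hom A B} (i : Iso f) → f ∘ inv i ≈ id
  isoʳ i = proj₂ (proj₂ i)

  iso-id : ∀ {A} → Iso (id {A})
  iso-id = id , identityˡ , identityˡ

  iso-inv : ∀ {A B} {f : Hom A B} (i : Iso f) → Iso (inv i)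
  iso-inv {f = f} (g , gf , fg) = f , fg , gf

  iso-∘ : ∀ {A B C} {f : Hom A B} {g : Hom B C} → Iso f → Iso g → Iso (g ∘ f)
  iso-∘ (f⁻ , f⁻f , ff⁻) (g⁻ , g⁻g , gg⁻) =
    f⁻ ∘ g⁻ , ≈.trans (cancelInner g⁻g) f⁻f , ≈.trans (cancelInner ff⁻) gg⁻

  iso-conjugate : ∀ {A A' B B'} {f : Hom A B} {f' : Hom A' B'} {φA : Hom A A'} {φB : Hom B B'}
                  (iA : Iso φA) (iB : Iso φB) → f' ∘ φA ≈ φB ∘ f → inv iB ∘ f' ≈ f ∘ inv iA
  iso-conjugate {f = f} {f'} {φA} {φB} iA iB sq = begin
    inv iB ∘ f'                    ≈⟨ cancelʳ (isoʳ iA) ⟨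
    ((inv iB ∘ f') ∘ φA) ∘ inv iA  ≈⟨ assoc ⟩∘⟨refl ⟩
    (inv iB ∘ (f' ∘ φA)) ∘ inv iA  ≈⟨ (refl⟩∘⟨ sq) ⟩∘⟨refl ⟩
    (inv iB ∘ (φB ∘ f)) ∘ inv iA   ≈⟨ cancelˡ (isoˡ iB) ⟩∘⟨refl ⟩
    f ∘ inv iA                     ∎

  IsPushout-id-unique : ∀ {A B C D} {f : Hom A B} {g : Hom A C} {i₁ : Hom B D} {i₂ : Hom C D} →
                        IsPushout f g i₁ i₂ → {u : Hom D D} → u ∘ i₁ ≈ i₁ → u ∘ i₂ ≈ i₂ → u ≈ id
  IsPushout-id-unique po {u} ui₁ ui₂ with IsPushout.universal po _ _ (IsPushout.commute po)
  ... | _ , _ , _ , unique = ≈.trans (unique u ui₁ ui₂) (≈.sym (unique id identityˡ identityˡ))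

  IsPushout-transport :
    ∀ {A B C D A' B' C' D'} {f : Hom A B} {g : Hom A C} {i₁ : Hom B D} {i₂ : Hom C D}
      {f' : Hom A' B'} {g' : Hom A' C'} {i₁' : Hom B' D'} {i₂' : Hom C' D'}
      {φA : Hom A A'} {φB : Hom B B'} {φC : Hom C C'} {φD : Hom D D'} →
    IsPushout f g i₁ i₂ → Iso φA → Iso φB → Iso φC → Iso φD →
    f' ∘ φA ≈ φB ∘ f → g' ∘ φA ≈ φC ∘ g → i₁' ∘ φB ≈ φD ∘ i₁ → i₂' ∘ φC ≈ φD ∘ i₂ →
    IsPushout f' g' i₁' i₂'
  IsPushout-transport {A} {D = D} {A'} {D' = D'} {f = f} {g} {i₁} {i₂} {f'} {g'} {i₁'} {i₂'}
                      {φA} {φB} {φC} {φD} po iA iB iC iD sf sg si₁ si₂ =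
    record { commute = commute ; universal = universal }
    where
    through : ∀ {B B'} {f : Hom A B} {f' : Hom A' _} {i : Hom B D} {i' : Hom B' D'}
                {φ : Hom B B'} → f' ∘ φA ≈ φ ∘ f → i' ∘ φ ≈ φD ∘ i →
              i' ∘ f' ≈ (φD ∘ (i ∘ f)) ∘ inv iA
    through {f = f} {f'} {i} {i'} {φ} sf si = begin
      i' ∘ f'                   ≈⟨ refl⟩∘⟨ cancelʳ (isoʳ iA) ⟨
      i' ∘ ((f' ∘ φA) ∘ inv iA) ≈⟨ refl⟩∘⟨ (sf ⟩∘⟨refl) ⟩
      i' ∘ ((φ ∘ f) ∘ inv iA)   ≈⟨ sym-assoc ⟩
      (i' ∘ (φ ∘ f)) ∘ inv iA   ≈⟨ sym-assoc ⟩∘⟨refl ⟩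
      ((i' ∘ φ) ∘ f) ∘ inv iA   ≈⟨ (si ⟩∘⟨refl) ⟩∘⟨refl ⟩
      ((φD ∘ i) ∘ f) ∘ inv iA   ≈⟨ assoc ⟩∘⟨refl ⟩
      (φD ∘ (i ∘ f)) ∘ inv iA   ∎

    commute : i₁' ∘ f' ≈ i₂' ∘ g'
    commute = begin
      i₁' ∘ f'                  ≈⟨ through sf si₁ ⟩
      (φD ∘ (i₁ ∘ f)) ∘ inv iA  ≈⟨ (refl⟩∘⟨ IsPushout.commute po) ⟩∘⟨refl ⟩
      (φD ∘ (i₂ ∘ g)) ∘ inv iA  ≈⟨ through sg si₂ ⟨
      i₂' ∘ g'                  ∎

    universal : ∀ {X} (h : Hom _ X) (k : Hom _ X) → h ∘ f' ≈ k ∘ g' →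
                Σ (Hom D' X) λ u → (u ∘ i₁' ≈ h) × (u ∘ i₂' ≈ k) ×
                  (∀ (u' : Hom D' X) → u' ∘ i₁' ≈ h → u' ∘ i₂' ≈ k → u' ≈ u)
    universal {X} h k hf'≈kg'
      with IsPushout.universal po (h ∘ φB) (k ∘ φC)
             (≈.trans (extendˡ h (≈.sym sf)) (≈.trans (hf'≈kg' ⟩∘⟨refl) (extendˡ k sg)))
    ... | u , ui₁ , ui₂ , unique = u ∘ inv iD , leg iB si₁ ui₁ , leg iC si₂ ui₂ , unique'
      where
      leg : ∀ {B B'} {i : Hom B D} {i' : Hom B' D'} {φ : Hom B B'} (iφ : Iso φ) {h : Hom B' X} →
            i' ∘ φ ≈ φD ∘ i → u ∘ i ≈ h ∘ φ → (u ∘ inv iD) ∘ i' ≈ h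
      leg {i = i} {i'} {φ} iφ {h} si ui = begin
        (u ∘ inv iD) ∘ i' ≈⟨ assoc ⟩
        u ∘ (inv iD ∘ i') ≈⟨ refl⟩∘⟨ iso-conjugate iφ iD si ⟩
        u ∘ (i ∘ inv iφ)  ≈⟨ sym-assoc ⟩
        (u ∘ i) ∘ inv iφ  ≈⟨ ui ⟩∘⟨refl ⟩
        (h ∘ φ) ∘ inv iφ  ≈⟨ cancelʳ (isoʳ iφ) ⟩
        h                 ∎

      unique' : ∀ (u' : Hom D' X) → u' ∘ i₁' ≈ h → u' ∘ i₂' ≈ k → u' ≈ u ∘ inv iD
      unique' u' u'i₁' u'i₂' = begin
        u'                 ≈⟨ cancelʳ (isoʳ iD) ⟨
        (u' ∘ φD) ∘ inv iD ≈⟨ unique (u' ∘ φD) (≈.trans (extendˡ u' (≈.sym si₁)) (u'i₁' ⟩∘⟨refl))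
                                               (≈.trans (extendˡ u' (≈.sym si₂)) (u'i₂' ⟩∘⟨refl))
                              ⟩∘⟨refl ⟩
        u ∘ inv iD         ∎

  IsPushout-unique :
    ∀ {A B C D A' B' C' D'} {f : Hom A B} {g : Hom A C} {i₁ : Hom B D} {i₂ : Hom C D}
      {f' : Hom A' B'} {g' : Hom A' C'} {i₁' : Hom B' D'} {i₂' : Hom C' D'}
      {φA : Hom A A'} {φB : Hom B B'} {φC : Hom C C'} →
    IsPushout f g i₁ i₂ → IsPushout f' g' i₁' i₂' → Iso φA → Iso φB → Iso φC →
    f' ∘ φA ≈ φB ∘ f → g' ∘ φA ≈ φC ∘ g →
    Σ (Hom D D') λ φD → Iso φD × (i₁' ∘ φB ≈ φD ∘ i₁) × (i₂' ∘ φC ≈ φD ∘ i₂)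
  IsPushout-unique {i₁ = i₁} {i₂} {i₁' = i₁'} {i₂'} {φB = φB} {φC} po po' iA iB iC sf sg
    with IsPushout.universal po (i₁' ∘ φB) (i₂' ∘ φC)
           (≈.trans (extendˡ i₁' (≈.sym sf))
             (≈.trans (IsPushout.commute po' ⟩∘⟨refl) (extendˡ i₂' sg)))
       | IsPushout.universal po' (i₁ ∘ inv iB) (i₂ ∘ inv iC)
           (≈.trans (extendˡ i₁ (iso-conjugate iA iB sf))
             (≈.trans (IsPushout.commute po ⟩∘⟨refl) (≈.sym (extendˡ i₂ (iso-conjugate iA iC sg)))))
  ... | d , di₁ , di₂ , _ | d⁻ , d⁻i₁' , d⁻i₂' , _ =
    d , (d⁻ , IsPushout-id-unique po (round iB di₁ d⁻i₁') (round iC di₂ d⁻i₂')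
            , IsPushout-id-unique po' (round (iso-inv iB) d⁻i₁' di₁) (round (iso-inv iC) d⁻i₂' di₂))
      , ≈.sym di₁ , ≈.sym di₂
    where
    round : ∀ {X Y Z W} {x : Hom X Y} {y : Hom Z W} {a : Hom Y W} {b : Hom W Y} {φ : Hom X Z}
            (iφ : Iso φ) → a ∘ x ≈ y ∘ φ → b ∘ y ≈ x ∘ inv iφ → (b ∘ a) ∘ x ≈ x
    round {x = x} {y} {a} {b} {φ} iφ ax by = begin
      (b ∘ a) ∘ x      ≈⟨ assoc ⟩
      b ∘ (a ∘ x)      ≈⟨ refl⟩∘⟨ ax ⟩
      b ∘ (y ∘ φ)      ≈⟨ sym-assoc ⟩
      (b ∘ y) ∘ φ      ≈⟨ by ⟩∘⟨refl ⟩
      (x ∘ inv iφ) ∘ φ ≈⟨ cancelʳ (isoˡ iφ) ⟩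
      x                ∎

  IsPushout-id : ∀ {A C} (g : Hom A C) → IsPushout id g g id
  IsPushout-id g = record
    { commute = id-comm
    ; universal = λ h k hid≈kg →
        k , ≈.trans (≈.sym hid≈kg) identityʳ , identityʳ , λ u' _ u'id≈k → ≈.trans (≈.sym identityʳ) u'id≈k
    }

  IsPushout-id⇒iso : ∀ {A C D} {u : Hom A C} {k : Hom A D} {π : Hom C D} → IsPushout id u k π → Iso π
  IsPushout-id⇒iso {u = u} {k} {π} po with IsPushout.universal po u id id-comm
  ... | w , wk , wπ , _ = w , wπ , IsPushout-id-unique po
    (begin (π ∘ w) ∘ k ≈⟨ assoc ⟩ π ∘ (w ∘ k) ≈⟨ refl⟩∘⟨ wk ⟩ π ∘ u ≈⟨ IsPushout.commute po ⟨
           k ∘ id ≈⟨ identityʳ ⟩ k ∎)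
    (begin (π ∘ w) ∘ π ≈⟨ assoc ⟩ π ∘ (w ∘ π) ≈⟨ refl⟩∘⟨ wπ ⟩ π ∘ id ≈⟨ identityʳ ⟩ π ∎)

  IsPullback-id : ∀ {A C} (g : Hom A C) → IsPullback g id id g
  IsPullback-id g = record
    { commute = id-comm
    ; universal = λ h k gh≈idk →
        h , identityˡ , ≈.trans gh≈idk identityˡ , λ u' idu'≈h _ → ≈.trans (≈.sym identityˡ) idu'≈h
    }

  Mono⇒IsPullback : ∀ {A B} {f : Hom A B} → Mono f → IsPullback f f id id
  Mono⇒IsPullback mono = record
    { commute = ≈.refl
    ; universal = λ h k fh≈fk →
        h , identityˡ , ≈.trans identityˡ (mono _ _ fh≈fk) , λ u' idu'≈h _ → ≈.trans (≈.sym identityˡ) idu'≈h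
    }

  IsPullback-sym : ∀ {A B C D} {f : Hom B D} {g : Hom C D} {p₁ : Hom A B} {p₂ : Hom A C} →
                   IsPullback f g p₁ p₂ → IsPullback g f p₂ p₁
  IsPullback-sym pb = record
    { commute = ≈.sym (IsPullback.commute pb)
    ; universal = λ h k gh≈fk →
        let (u , p₁u , p₂u , unique) = IsPullback.universal pb k h (≈.sym gh≈fk)
        in u , p₂u , p₁u , λ u' p₂u' p₁u' → unique u' p₁u' p₂u'
    }

  IsPullback-jointlyMono : ∀ {A B C D X} {f : Hom B D} {g : Hom C D} {p₁ : Hom A B} {p₂ : Hom A C} →
                           IsPullback f g p₁ p₂ → {x y : Hom X A} →
                           p₁ ∘ x ≈ p₁ ∘ y → p₂ ∘ x ≈ p₂ ∘ y → x ≈ y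
  IsPullback-jointlyMono {p₁ = p₁} {p₂} pb {x} {y} p₁x≈p₁y p₂x≈p₂y
    with IsPullback.universal pb (p₁ ∘ y) (p₂ ∘ y)
           (≈.trans sym-assoc (≈.trans (IsPullback.commute pb ⟩∘⟨refl) assoc))
  ... | _ , _ , _ , unique = ≈.trans (unique x p₁x≈p₁y p₂x≈p₂y) (≈.sym (unique y ≈.refl ≈.refl))

  -- The van Kampen property, applied to the cube whose top face is the trivial
  -- pushout of g along id.
  M-pushout⇒pullback : ∀ {A B C D} {f : Hom A B} {g : Hom A C} {g' : Hom B D} {f' : Hom C D} →
                       M f → IsPushout f g g' f' → IsPullback g' f' f g
  M-pushout⇒pullback {f = f} {g} {f' = f'} f∈M po =
    proj₁ (proj₁ (van-Kampen f∈M po id g g id id f id f' f∈M (M-iso iso-id)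
                    (pushout-stable (IsPushout-sym po) f∈M)
                    id-comm ≈.refl id-comm (IsPushout.commute po) ≈.refl
                    (Mono⇒IsPullback (M-mono f∈M)) (IsPullback-id g))
                  (IsPushout-id g))

  pushoutComplements-commute :
    ∀ {K O Q K₁ K₂} {o : Hom K O} {a : Hom O Q} {k₁ : Hom K K₁} {o₁ : Hom K₁ Q}
      {k₂ : Hom K K₂} {o₂ : Hom K₂ Q} →
    IsPushout o k₁ a o₁ → IsPushout o k₂ a o₂ → o₁ ∘ k₁ ≈ o₂ ∘ k₂
  pushoutComplements-commute po₁ po₂ = ≈.trans (≈.sym (IsPushout.commute po₁)) (IsPushout.commute po₂)

  -- In the cube over the pushout (o, k₁, a, o₁) with top face (id, u, k₂, π₂)
  -- the front faces are pullbacks, so by van Kampen the top face is a pushout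
  -- of an identity and π₂ is an isomorphism.
  pushoutComplements-pullback⇒iso :
    ∀ {K O Q K₁ K₂ P} {o : Hom K O} {a : Hom O Q} {k₁ : Hom K K₁} {o₁ : Hom K₁ Q}
      {k₂ : Hom K K₂} {o₂ : Hom K₂ Q} {π₁ : Hom P K₁} {π₂ : Hom P K₂} →
    M o → M o₂ → IsPushout o k₁ a o₁ → IsPushout o k₂ a o₂ → IsPullback o₁ o₂ π₁ π₂ → Iso π₂
  pushoutComplements-pullback⇒iso {o = o} {k₁ = k₁} {o₁} {k₂} {o₂} {π₁} {π₂} o∈M o₂∈M po₁ po₂ pb
    with IsPullback.universal pb k₁ k₂ (pushoutComplements-commute po₁ po₂)
  ... | u , π₁u , π₂u , _ =
    IsPushout-id⇒iso
      (proj₂ (van-Kampen o∈M po₁ id u k₂ π₂ id o π₁ o₂ o∈M (pullback-stable pb o₂∈M) o₂∈M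
                (≈.trans identityʳ (≈.sym π₂u)) ≈.refl (≈.trans identityʳ (≈.sym π₁u))
                (IsPushout.commute po₂) (IsPullback.commute pb)
                (Mono⇒IsPullback (M-mono o∈M)) back-face)
             (M-pushout⇒pullback o∈M po₂ , pb))
    where
    back-face : IsPullback k₁ π₁ id u
    back-face = record
      { commute = ≈.trans identityʳ (≈.sym π₁u)
      ; universal = λ h k k₁h≈π₁k → h , identityˡ ,
          IsPullback-jointlyMono pb (≈.trans sym-assoc (≈.trans (π₁u ⟩∘⟨refl) k₁h≈π₁k))
            (M-mono o₂∈M _ _ (begin
              o₂ ∘ π₂ ∘ u ∘ h   ≈⟨ refl⟩∘⟨ ≈.trans sym-assoc (π₂u ⟩∘⟨refl) ⟩
              o₂ ∘ k₂ ∘ h       ≈⟨ sym-assoc ⟩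
              (o₂ ∘ k₂) ∘ h     ≈⟨ pushoutComplements-commute po₁ po₂ ⟩∘⟨refl ⟨
              (o₁ ∘ k₁) ∘ h     ≈⟨ assoc ⟩
              o₁ ∘ k₁ ∘ h       ≈⟨ refl⟩∘⟨ k₁h≈π₁k ⟩
              o₁ ∘ π₁ ∘ k       ≈⟨ sym-assoc ⟩
              (o₁ ∘ π₁) ∘ k     ≈⟨ IsPullback.commute pb ⟩∘⟨refl ⟩
              (o₂ ∘ π₂) ∘ k     ≈⟨ assoc ⟩
              o₂ ∘ π₂ ∘ k       ∎))
          , λ u' idu'≈h _ → ≈.trans (≈.sym identityˡ) idu'≈h
      }

  pushoutComplement-unique :
    ∀ {K O Q K₁ K₂} {o : Hom K O} {a : Hom O Q} {k₁ : Hom K K₁} {o₁ : Hom K₁ Q}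
      {k₂ : Hom K K₂} {o₂ : Hom K₂ Q} →
    M o → IsPushout o k₁ a o₁ → IsPushout o k₂ a o₂ →
    Σ (Hom K₁ K₂) λ β → Iso β × (β ∘ k₁ ≈ k₂) × (o₂ ∘ β ≈ o₁)
  pushoutComplement-unique {k₁ = k₁} {o₁} {k₂} {o₂} o∈M po₁ po₂
    with pullback-along-M o₁ o₂ (pushout-stable (IsPushout-sym po₂) o∈M)
  ... | record { p₁ = π₁ ; p₂ = π₂ ; isPullback = pb }
    with IsPullback.universal pb k₁ k₂ (pushoutComplements-commute po₁ po₂)
  ... | _ , π₁u , π₂u , _ =
    π₂ ∘ inv iπ₁ , iso-∘ (iso-inv iπ₁) iπ₂ ,
    ≈.trans (refl⟩∘⟨ ≈.sym π₁u) (≈.trans (cancelInner (isoˡ iπ₁)) π₂u) ,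
    ≈.trans sym-assoc (≈.trans (≈.sym (IsPullback.commute pb) ⟩∘⟨refl) (cancelʳ (isoʳ iπ₁)))
    where
    iπ₂ = pushoutComplements-pullback⇒iso o∈M (pushout-stable (IsPushout-sym po₂) o∈M) po₁ po₂ pb
    iπ₁ = pushoutComplements-pullback⇒iso o∈M (pushout-stable (IsPushout-sym po₁) o∈M) po₂ po₁
            (IsPullback-sym pb)

  coproduct-ext : ∀ {A B X} {h k : Hom (A + B) X} → h ∘ inl ≈ k ∘ inl → h ∘ inr ≈ k ∘ inr → h ≈ k
  coproduct-ext hl≈kl hr≈kr = ≈.trans (copair-unique hl≈kl hr≈kr) (≈.sym (copair-unique ≈.refl ≈.refl))

  ¡-pushout : ∀ {A B} → IsPushout (¡ A) (¡ B) (inl {A} {B}) inr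
  ¡-pushout {A} {B} = record
    { commute = ≈.trans (¡-unique _) (≈.sym (¡-unique _))
    ; universal = λ h k _ → [ h , k ] , inl-commute , inr-commute , λ _ u'l u'r → copair-unique u'l u'r
    }

  inr-pushout : ∀ {A B C} (f : Hom A B) → IsPushout f (inr {C} {A}) (inr {C} {B}) (C ⊕ f)
  inr-pushout {A} {B} {C} f = record { commute = ≈.sym inr-commute ; universal = universal }
    where
    universal : ∀ {X} (h : Hom B X) (k : Hom (C + A) X) → h ∘ f ≈ k ∘ inr →
                Σ (Hom (C + B) X) λ u → (u ∘ inr ≈ h) × (u ∘ (C ⊕ f) ≈ k) ×
                  (∀ (u' : Hom (C + B) X) → u' ∘ inr ≈ h → u' ∘ (C ⊕ f) ≈ k → u' ≈ u)
    universal h k hf≈kr = [ k ∘ inl , h ] , inr-commute , on-⊕ , unique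
      where
      on-⊕ : [ k ∘ inl , h ] ∘ (C ⊕ f) ≈ k
      on-⊕ = coproduct-ext
        (≈.trans assoc (≈.trans (refl⟩∘⟨ inl-commute) inl-commute))
        (≈.trans assoc (≈.trans (refl⟩∘⟨ inr-commute)
          (≈.trans sym-assoc (≈.trans (inr-commute ⟩∘⟨refl) hf≈kr))))
      unique : ∀ u' → u' ∘ inr ≈ h → u' ∘ (C ⊕ f) ≈ k → u' ≈ [ k ∘ inl , h ]
      unique u' u'r u'⊕ = copair-unique
        (≈.trans (refl⟩∘⟨ ≈.sym inl-commute) (≈.trans sym-assoc (u'⊕ ⟩∘⟨refl))) u'r

  inl-pushout : ∀ {A B C} (f : Hom A B) → IsPushout f (inl {A} {C}) (inl {B} {C}) [ inl ∘ f , inr ]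
  inl-pushout {A} {B} {C} f = record { commute = ≈.sym inl-commute ; universal = universal }
    where
    universal : ∀ {X} (h : Hom B X) (k : Hom (A + C) X) → h ∘ f ≈ k ∘ inl →
                Σ (Hom (B + C) X) λ u → (u ∘ inl ≈ h) × (u ∘ [ inl ∘ f , inr ] ≈ k) ×
                  (∀ (u' : Hom (B + C) X) → u' ∘ inl ≈ h → u' ∘ [ inl ∘ f , inr ] ≈ k → u' ≈ u)
    universal h k hf≈kl = [ h , k ∘ inr ] , inl-commute , on-copair , unique
      where
      on-copair : [ h , k ∘ inr ] ∘ [ inl ∘ f , inr ] ≈ k
      on-copair = coproduct-ext
        (≈.trans assoc (≈.trans (refl⟩∘⟨ inl-commute)
          (≈.trans sym-assoc (≈.trans (inl-commute ⟩∘⟨refl) hf≈kl))))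
        (≈.trans assoc (≈.trans (refl⟩∘⟨ inr-commute) inr-commute))
      unique : ∀ u' → u' ∘ inl ≈ h → u' ∘ [ inl ∘ f , inr ] ≈ k → u' ≈ [ h , k ∘ inr ]
      unique u' u'l u'c = copair-unique u'l
        (≈.trans (refl⟩∘⟨ ≈.sym inr-commute) (≈.trans sym-assoc (u'c ⟩∘⟨refl)))

  ⊨-resp-≈ : ∀ {P X} (c : Cond P) {p p' : Hom P X} → p ≈ p' → p ⊨ c → p' ⊨ c
  ⊨-resp-≈ tt p≈p' s = s
  ⊨-resp-≈ (ex a a∈M c) p≈p' (q , q∈M , p≈qa , qs) = q , q∈M , ≈.trans (≈.sym p≈p') p≈qa , qs
  ⊨-resp-≈ (neg c) p≈p' ¬s s' = ¬s (⊨-resp-≈ c (≈.sym p≈p') s')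
  ⊨-resp-≈ (conj I c) p≈p' s i = ⊨-resp-≈ (c i) p≈p' (s i)

  -- Transport α c c' says that c' is obtained from c by moving every
  -- existential along isomorphisms compatible with α; conjunctions may be
  -- reindexed, as long as every conjunct on either side has a counterpart.
  data Transport : ∀ {O O'} → Hom O O' → Cond O → Cond O' → Set (suc κ) where
    tt   : ∀ {O O'} {α : Hom O O'} → Transport α tt tt
    neg  : ∀ {O O'} {α : Hom O O'} {c c'} → Transport α c c' → Transport α (neg c) (neg c')
    conj : ∀ {O O'} {α : Hom O O'} {J J' : Set κ} {c : J → Cond O} {c' : J' → Cond O'}
           (f : J → J') → (∀ j → Transport α (c j) (c' (f j))) →
           (g : J' → J) → (∀ j → Transport α (c (g j)) (c' j)) →
           Transport α (conj J c) (conj J' c')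
    ex   : ∀ {O O' Q Q'} {α : Hom O O'} {a : Hom O Q} {a∈M : M a} {c}
             {a' : Hom O' Q'} {a'∈M : M a'} {c'}
           (α' : Hom Q Q') → Iso α' → a' ∘ α ≈ α' ∘ a → Transport α' c c' →
           Transport α (ex a a∈M c) (ex a' a'∈M c')

  ⊨-Transport : ∀ {O O'} {α : Hom O O'} {c c'} → Transport α c c' → Iso α →
                ∀ {X} (q : Hom O' X) → q ⊨ c' ⇔ (q ∘ α) ⊨ c
  ⊨-Transport tt iα q = mk⇔ _ _
  ⊨-Transport (neg T) iα q = mk⇔
    (λ ¬s s → ¬s (Equivalence.from (⊨-Transport T iα q) s))
    (λ ¬s s → ¬s (Equivalence.to (⊨-Transport T iα q) s))
  ⊨-Transport (conj f Tf g Tg) iα q = mk⇔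
    (λ s j → Equivalence.to (⊨-Transport (Tf j) iα q) (s (f j)))
    (λ s j → Equivalence.from (⊨-Transport (Tg j) iα q) (s (g j)))
  ⊨-Transport {α = α} (ex {a = a} {a∈M} {c} {a'} {a'∈M} {c'} α' iα' a'α≈α'a T) iα q =
    mk⇔ forth back
    where
    forth : q ⊨ ex a' a'∈M c' → (q ∘ α) ⊨ ex a a∈M c
    forth (w , w∈M , q≈wa' , ws) =
      w ∘ α' , M-comp (M-iso iα') w∈M , ≈.trans (q≈wa' ⟩∘⟨refl) (extendˡ w a'α≈α'a) ,
      Equivalence.to (⊨-Transport T iα' w) ws
    back : (q ∘ α) ⊨ ex a a∈M c → q ⊨ ex a' a'∈M c'
    back (w , w∈M , qα≈wa , ws) =
      w ∘ inv iα' , M-comp (M-iso (iso-inv iα')) w∈M ,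
      (begin
        q                    ≈⟨ cancelʳ (isoʳ iα) ⟨
        (q ∘ α) ∘ inv iα     ≈⟨ qα≈wa ⟩∘⟨refl ⟩
        (w ∘ a) ∘ inv iα     ≈⟨ assoc ⟩
        w ∘ (a ∘ inv iα)     ≈⟨ refl⟩∘⟨ iso-conjugate iα iα' a'α≈α'a ⟨
        w ∘ (inv iα' ∘ a')   ≈⟨ sym-assoc ⟩
        (w ∘ inv iα') ∘ a'   ∎) ,
      Equivalence.from (⊨-Transport T iα' (w ∘ inv iα'))
        (⊨-resp-≈ c (≈.sym (cancelʳ (isoˡ iα'))) ws)

  Transport-≡ff : ∀ {O O'} {α : Hom O O'} {c c'} → Transport α c c' → Iso α → c ≡c ff → c' ≡c ff
  Transport-≡ff {α = α} T iα c≡ff p p∈M =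
    (λ s → proj₁ (c≡ff (p ∘ α) (M-comp (M-iso iα) p∈M)) (Equivalence.to (⊨-Transport T iα p) s)) ,
    (λ ¬⊤ → ⊥-elim (¬⊤ _))

  Transport-refl : ∀ {O} (c : Cond O) → Transport id c c
  Transport-refl tt = tt
  Transport-refl (ex a a∈M c) = ex id iso-id id-comm (Transport-refl c)
  Transport-refl (neg c) = neg (Transport-refl c)
  Transport-refl (conj I c) = conj (λ j → j) (λ j → Transport-refl (c j)) (λ j → j) (λ j → Transport-refl (c j))

  Transport-∧ : ∀ {O O'} {α : Hom O O'} {c c' d d'} →
                Transport α c c' → Transport α d d' → Transport α (c ∧ d) (c' ∧ d')
  Transport-∧ Tc Td =
    conj (λ j → j) (λ { (lift true) → Tc ; (lift false) → Td })
         (λ j → j) (λ { (lift true) → Tc ; (lift false) → Td })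

  Shift-Transport : ∀ {P Q Q'} {p : Hom P Q} {p' : Hom P Q'} {α : Hom Q Q'} → Iso α → p' ≈ α ∘ p →
                    (c : Cond P) → Transport α (Shift p c) (Shift p' c)
  Shift-Transport iα p'≈αp tt = tt
  Shift-Transport {p = p} {p'} {α} iα p'≈αp (ex a a∈M c) =
    neg (conj forth (λ j → neg (ex id iso-id (≈.trans (cancelʳ (isoˡ iα)) (≈.sym identityˡ))
                                  (Transport-refl _)))
              back  (λ j → neg (ex id iso-id (≈.sym identityˡ) (Transport-refl _))))
    where
    forth : ShiftIdx p a → ShiftIdx p' a
    forth j = record
      { x = x ; p'' = α ∘ p'' ; a'' = a'' ; x-M = x-M ; p''-M = M-comp p''-M (M-iso iα) ; a''-M = a''-M
      ; p-eq = ≈.trans assoc (≈.trans (refl⟩∘⟨ p-eq) (≈.sym p'≈αp)) ; a-eq = a-eq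
      ; r = r ∘ inv iα ; s = s
      ; po = IsPushout-transport po iso-id iα iso-id iso-id identityʳ id-comm
               (≈.trans (cancelʳ (isoˡ iα)) (≈.sym identityˡ)) id-comm
      }
      where open ShiftIdx j
    back : ShiftIdx p' a → ShiftIdx p a
    back j = record
      { x = x ; p'' = inv iα ∘ p'' ; a'' = a'' ; x-M = x-M
      ; p''-M = M-comp p''-M (M-iso (iso-inv iα)) ; a''-M = a''-M
      ; p-eq = ≈.trans assoc (≈.trans (refl⟩∘⟨ ≈.trans p-eq p'≈αp) (cancelˡ (isoˡ iα)))
      ; a-eq = a-eq
      ; r = r ∘ α ; s = s
      ; po = IsPushout-transport po iso-id (iso-inv iα) iso-id iso-id identityʳ id-comm
               (≈.trans (cancelʳ (isoʳ iα)) (≈.sym identityˡ)) id-comm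
      }
      where open ShiftIdx j
  Shift-Transport iα p'≈αp (neg c) = neg (Shift-Transport iα p'≈αp c)
  Shift-Transport iα p'≈αp (conj I c) =
    conj (λ j → j) (λ j → Shift-Transport iα p'≈αp (c j)) (λ j → j) (λ j → Shift-Transport iα p'≈αp (c j))

  pushoutComplement-transport :
    ∀ {K O Q K' O' Q' L} {o : Hom K O} {a : Hom O Q} {o' : Hom K' O'} {a' : Hom O' Q'}
      {k' : Hom K' L} {n' : Hom L Q'} {α : Hom O O'} {β : Hom K K'} {α' : Hom Q Q'} →
    (iα : Iso α) (iβ : Iso β) (iα' : Iso α') → o' ∘ β ≈ α ∘ o → a' ∘ α ≈ α' ∘ a →
    IsPushout o' k' a' n' → IsPushout o (k' ∘ β) a (inv iα' ∘ n')
  pushoutComplement-transport iα iβ iα' o'β≈αo a'α≈α'a po =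
    IsPushout-transport po (iso-inv iβ) (iso-inv iα) iso-id (iso-inv iα')
      (≈.sym (iso-conjugate iβ iα o'β≈αo)) (≈.trans (cancelʳ (isoʳ iβ)) (≈.sym identityˡ))
      (≈.sym (iso-conjugate iα iα' a'α≈α'a)) identityʳ

  Trans-Transport :
    ∀ {O K I O' K' I'} {o : Hom K O} {i : Hom K I} {o' : Hom K' O'} {i' : Hom K' I'}
      {c c' t t'} {α : Hom O O'} {β : Hom K K'} {γ : Hom I I'} →
    Iso α → Iso β → Iso γ → M o → o' ∘ β ≈ α ∘ o → i' ∘ β ≈ γ ∘ i →
    Transport α c c' → IsTrans o i c t → IsTrans o' i' c' t' → Transport γ t t'
  Trans-Transport iα iβ iγ o∈M so si tt tr-tt tr-tt = tt
  Trans-Transport iα iβ iγ o∈M so si (neg T) (tr-neg tr) (tr-neg tr') =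
    neg (Trans-Transport iα iβ iγ o∈M so si T tr tr')
  Trans-Transport iα iβ iγ o∈M so si (conj f Tf g Tg) (tr-conj tr) (tr-conj tr') =
    conj f (λ j → Trans-Transport iα iβ iγ o∈M so si (Tf j) (tr j) (tr' (f j)))
         g (λ j → Trans-Transport iα iβ iγ o∈M so si (Tg j) (tr (g j)) (tr' j))
  Trans-Transport iα iβ iγ o∈M so si (ex α' iα' sa T)
                  (tr-ex _ _ _ k o₁ pc _ _ po _ tr) (tr-ex _ _ _ k' o₁' pc' _ _ po' _ tr') =
    let (β' , iβ' , β'k≈k'β , α'⁻o₁'β'≈o₁) =
          pushoutComplement-unique o∈M pc (pushoutComplement-transport iα iβ iα' so sa pc')
        (γ' , iγ' , sa* , si₁) = IsPushout-unique po po' iβ iγ iβ' si (≈.sym β'k≈k'β)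
        so₁ = begin
          o₁' ∘ β'                    ≈⟨ cancelˡ (isoʳ iα') ⟩∘⟨refl ⟨
          (α' ∘ (inv iα' ∘ o₁')) ∘ β' ≈⟨ assoc ⟩
          α' ∘ ((inv iα' ∘ o₁') ∘ β') ≈⟨ refl⟩∘⟨ α'⁻o₁'β'≈o₁ ⟩
          α' ∘ o₁                     ∎
    in ex γ' iγ' sa* (Trans-Transport iα' iβ' iγ' (pushout-stable (IsPushout-sym pc) o∈M) so₁ si₁ T tr tr')
  Trans-Transport iα iβ iγ o∈M so si (ex α' iα' sa T) (tr-ex _ _ _ k o₁ pc _ _ _ _ _) (tr-ex-none _ _ _ ¬pc') =
    ⊥-elim (¬pc' (record { isPushout =
      pushoutComplement-transport (iso-inv iα) (iso-inv iβ) (iso-inv iα')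
        (≈.sym (iso-conjugate iβ iα so)) (≈.sym (iso-conjugate iα iα' sa)) pc }))
  Trans-Transport iα iβ iγ o∈M so si (ex α' iα' sa T) (tr-ex-none _ _ _ ¬pc) (tr-ex _ _ _ k' o₁' pc' _ _ _ _ _) =
    ⊥-elim (¬pc (record { isPushout = pushoutComplement-transport iα iβ iα' so sa pc' }))
  Trans-Transport iα iβ iγ o∈M so si (ex α' iα' sa T) (tr-ex-none _ _ _ _) (tr-ex-none _ _ _ _) = neg tt

  module TrivialMatch (R₁ R₂ : RuleAC) {t : Cond (RuleAC.I R₂ + RuleAC.I R₁)}
                      (tr : IsTrans (RuleAC.I R₂ ⊕ RuleAC.o R₁) (RuleAC.I R₂ ⊕ RuleAC.i R₁)
                                    (Shift inl (RuleAC.c R₂)) t) where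
    private
      module R₁ = RuleAC R₁
      module R₂ = RuleAC R₂

    coproductAdmissibilityData : AdmissibilityData R₂ R₁ (¡ R₂.I) (¡ R₁.O)
    coproductAdmissibilityData = record
      { m₂' = inl ; m₁' = inr ; N-po = ¡-pushout
      ; k₂ = inl ; n₂ = [ inl ∘ R₂.i , inr ] ; K₂'-pc = inl-pushout R₂.i
      ; k₁ = inr ; n₁ = R₂.I ⊕ R₁.o ; K₁'-pc = inr-pushout R₁.o
      ; p₁ = inr ; j₁ = R₂.I ⊕ R₁.i ; I₂₁-po = inr-pushout R₁.i
      ; trans = t ; trans-is = tr
      }

    module _ (D : AdmissibilityData R₂ R₁ (¡ R₂.I) (¡ R₁.O)) where
      open AdmissibilityData D using (I₂₁; N-po; K₁'-pc; I₂₁-po; trans-is; composite)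

      composite-Transport : Σ (Hom (R₂.I + R₁.I) I₂₁) λ φ → Iso φ × Transport φ (Shift inr R₁.c ∧ t) composite
      -- ψ : I₂ + O₁ ≅ N₂₁, χ : I₂ + K₁ ≅ K₁' and φ : I₂ + I₁ ≅ I₂₁ compare D with
      -- the coproduct construction.
      composite-Transport =
        let (ψ , iψ , m₂'≈ψinl , m₁'≈ψinr) =
              IsPushout-unique ¡-pushout N-po iso-id iso-id iso-id id-comm id-comm
            (χ , iχ , χinr≈k₁ , n₁χ≈ψ⊕) =
              pushoutComplement-unique R₁.o-M
                (IsPushout-transport (inr-pushout R₁.o) iso-id iso-id iso-id iψ
                   id-comm id-comm m₁'≈ψinr identityʳ)
                K₁'-pc
            (φ , iφ , p₁≈φinr , j₁χ≈φ⊕) =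
              IsPushout-unique (inr-pushout R₁.i) I₂₁-po iso-id iso-id iχ
                id-comm (≈.trans identityʳ (≈.sym χinr≈k₁))
        in φ , iφ ,
           Transport-∧ (Shift-Transport iφ (≈.trans (≈.sym identityʳ) p₁≈φinr) R₁.c)
                       (Trans-Transport iψ iχ iφ (pushout-stable (IsPushout-sym (inr-pushout R₁.o)) R₁.o-M)
                          n₁χ≈ψ⊕ j₁χ≈φ⊕ (Shift-Transport iψ (≈.trans (≈.sym identityʳ) m₂'≈ψinl) R₂.c)
                          tr trans-is)

    admissible⇒consistent : Admissible R₂ R₁ (¡ R₂.I) (¡ R₁.O) → ¬ ((Shift inr R₁.c ∧ t) ≡c ff)
    admissible⇒consistent (D , consistent) canonical≡ff =
      let (φ , iφ , T) = composite-Transport D in consistent (Transport-≡ff T iφ canonical≡ff)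

lemma4p13 : ∀ {o ℓ e m} {𝐂 : Category o ℓ e} {M : MorClass 𝐂 m} (S : DPOSetting 𝐂 M) →
    let open DPOSetting S in let open DPO S in
    (R₁ R₂ : RuleAC) →
    (t : Cond (RuleAC.I R₂ + RuleAC.I R₁)) →
    IsTrans (RuleAC.I R₂ ⊕ RuleAC.o R₁) (RuleAC.I R₂ ⊕ RuleAC.i R₁)
            (Shift (inl {RuleAC.I R₂} {RuleAC.O R₁}) (RuleAC.c R₂)) t →
    (Admissible R₂ R₁ (¡ (RuleAC.I R₂)) (¡ (RuleAC.O R₁))
      ⇔ (¬ ((Shift (inr {RuleAC.I R₂} {RuleAC.I R₁}) (RuleAC.c R₁) ∧ t) ≡c ff)))
lemma4p13 S R₁ R₂ t tr =
  mk⇔ admissible⇒consistent (λ consistent → coproductAdmissibilityData , consistent)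
  where
  open Development S
  open TrivialMatch R₁ R₂ tr
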